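{- Let $(P,Q)$ be a pair of Dyck paths of size $n$ with $e_i(P)\le e_i(Q)$ for all $0\le i\le n$. Let $T=\omega^{ -1}(P)$, let $v_0$ be the root vertex of $T$ and $u_0,\dots,u_{n-1}$ its other vertices in clockwise order. Then $P\le_T Q$ if and only if $\delta_i(P,Q)\le\delta_j(P,Q)$ whenever $u_i$ is the parent of $u_j$.
   Context: Dyck paths: words in $N$ ($+1$), $S$ ($-1$) with $n$ of each letter and every prefix having at least as many $N$ as $S$, written $P=NS^{\alpha_1}\cdots NS^{\alpha_n}$; $e_i(P)=i-\sum_{j\le i}\alpha_j$ for $0\le i\le n$; $\delta_i(P,Q)=e_i(Q)-e_i(P)$. Plane trees: a plane tree is a tree embedded in the plane (rooted planar map whose graph is a tree) with a distinguished root corner at its root vertex; its clockwise tour follows its border from the root corner back to it; $\omega(T)$ is the word recording $N$ the first time an edge is followed and $S$ the second time; $\omega$ is a bijection from plane trees with $n$ edges to Dyck paths of size $n$; the clockwise order of vertices is the order of first encounter in the tour. Tamari order: binary trees are a leaf $\circ$ or an ordered pair $(B_1,B_2)$ of binary trees; $\sigma(\circ)=$ empty word, $\sigma((B_1,B_2))=\sigma(B_1)N\sigma(B_2)S$ is a bijection from binary trees with $n$ nodes to Dyck paths of size $n$; the Tamari order on binary trees is the reflexive-transitive closure of: a tree containing a subtree $((B_1,B_2),B_3)$ is below the tree obtained by replacing it with $(B_1,(B_2,B_3))$; $P\le_T Q$ means $\sigma^{ -1}(P)\le\sigma^{ -1}(Q)$. -}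

module Defs where

open import Data.Nat using (ℕ; zero; suc; _+_; _*_)
open import Data.Integer as ℤ using (ℤ; +_; _-_)
open import Data.List using (List; []; _∷_; _++_; [_]; take; length)
open import Data.Nat.ListAction using (sum)
open import Data.Maybe using (Maybe; just; nothing)
open import Data.Product using (_×_; _,_; proj₁; proj₂; Σ-syntax)
open import Relation.Binary.PropositionalEquality using (_≡_)
open import Relation.Binary.Construct.Closure.ReflexiveTransitive using (Star)

data Step : Set where
  N S : Step

walk : ℕ → List Step → Maybe ℕ
walk h [] = just h
walk h (N ∷ w) = walk (suc h) w
walk zero (S ∷ w) = nothing
walk (suc h) (S ∷ w) = walk h w

-- w is a Dyck path of size n: length 2n, every prefix has at least as many
-- N as S (the walk never fails), and it ends at height 0 (as many N as S).
IsDyck : ℕ → List Step → Set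
IsDyck n w = (length w ≡ n + n) × (walk 0 w ≡ just 0)

-- blocks w = (number of leading S's of w , [α₁, α₂, …] for the rest)
blocks : List Step → ℕ × List ℕ
blocks [] = 0 , []
blocks (S ∷ w) = suc (proj₁ (blocks w)) , proj₂ (blocks w)
blocks (N ∷ w) = 0 , (proj₁ (blocks w) ∷ proj₂ (blocks w))

-- for P = N S^{α₁} ⋯ N S^{αₙ}, alphas P = [α₁, …, αₙ]
alphas : List Step → List ℕ
alphas w = proj₂ (blocks w)

e : ℕ → List Step → ℤ
e i P = + i - + sum (take i (alphas P))

δ : ℕ → List Step → List Step → ℤ
δ i P Q = e i Q - e i P

-- Plane trees (rooted ordered trees; children listed in clockwise order)

data PTree : Set where
  node : List PTree → PTree

-- ω: N the first time an edge is followed, S the second time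
mutual
  ω : PTree → List Step
  ω (node ts) = ωs ts

  ωs : List PTree → List Step
  ωs [] = []
  ωs (t ∷ ts) = N ∷ ω t ++ S ∷ ωs ts

-- Non-root vertices are labelled 0,1,… in clockwise order (order of first
-- encounter in the tour, i.e. preorder).  goCh p k ts processes the list of
-- children ts of a vertex with label p (nothing = root), the next free label
-- being k; returns the parent pairs (i , j) ("u_i is the parent of u_j")
-- and the next free label.
edgeTo : Maybe ℕ → ℕ → List (ℕ × ℕ)
edgeTo nothing k = []
edgeTo (just i) k = [ (i , k) ]

goCh : Maybe ℕ → ℕ → List PTree → List (ℕ × ℕ) × ℕ
goCh p k [] = [] , k
goCh p k (node cs ∷ ts) =
  let r₁ = goCh (just k) (suc k) cs
      r₂ = goCh p (proj₂ r₁) ts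
  in (edgeTo p k ++ proj₁ r₁ ++ proj₁ r₂) , proj₂ r₂

parentPairs : PTree → List (ℕ × ℕ)
parentPairs (node ts) = proj₁ (goCh nothing 0 ts)

data BTree : Set where
  leaf : BTree
  bin  : BTree → BTree → BTree

σ : BTree → List Step
σ leaf = []
σ (bin B₁ B₂) = σ B₁ ++ N ∷ σ B₂ ++ [ S ]

data Rot : BTree → BTree → Set where
  rot   : ∀ B₁ B₂ B₃ → Rot (bin (bin B₁ B₂) B₃) (bin B₁ (bin B₂ B₃))
  left  : ∀ {A A′ B} → Rot A A′ → Rot (bin A B) (bin A′ B)
  right : ∀ {A B B′} → Rot B B′ → Rot (bin A B) (bin A B′)

_≤Tam_ : BTree → BTree → Set
_≤Tam_ = Star Rot

-- P ≤_T Q  iff  σ⁻¹(P) ≤ σ⁻¹(Q)  (σ is a bijection)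
_≤T_ : List Step → List Step → Set
P ≤T Q = Σ[ B ∈ BTree ] Σ[ C ∈ BTree ] (σ B ≡ P) × (σ C ≡ Q) × (B ≤Tam C)

module Submission where

-- Encode a Dyck path by its heights E i = e_i.  The parent relation of
-- T = ω⁻¹(P) is read off E: u_a is the parent of u_b iff E b = E a + 1 and E
-- stays above E a in between.  A Tamari rotation raises E by one on a block
-- [j, m) inside which E stays above E j.  (⇒) Parent-monotonicity of
-- δ(·, Q) transfers from each tree of a rotation chain to the one before it,
-- starting from Q itself, where δ = 0.  (⇐) While E_P ≠ E_Q, the first index
-- j with E_P j < E_Q j is a descent of E_P, so some rotation raises a block
-- starting at j; parent-monotonicity forces E_P < E_Q on the whole block, so
-- the raised sequence is still below E_Q and parent-monotone.  The sum of the
-- heights grows with each rotation, so the process reaches Q.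

open import Defs
open import Data.List using (List; []; _∷_; _++_; [_]; take; length; map)
open import Data.List.Properties using (map-++; length-map; length-++; ++-assoc; ∷-injectiveʳ; ++-identityʳ; ++-conicalʳ)
open import Data.Nat using (ℕ; zero; suc; _+_; _∸_; _≤_; _<_; z≤n; s≤s; pred; _<?_)
import Data.Integer as ℤ
open import Data.Integer using (_⊖_) renaming (_≤_ to _≤ℤ_)
import Data.Integer.Properties as ℤₚ
open import Data.Nat.Properties
open import Data.Nat.ListAction using (sum)
open import Data.Maybe using (Maybe; just; nothing)
open import Data.Product using (_×_; _,_; proj₁; proj₂; Σ)
open import Data.Sum using (_⊎_; inj₁; inj₂; [_,_]′)
open import Data.List.Membership.Propositional using (_∈_)
open import Data.List.Membership.Propositional.Properties using (∈-++⁺ˡ; ∈-++⁺ʳ; ∈-++⁻)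
open import Data.List.Relation.Unary.Any using (here)
open import Function using (_∘_)
open import Function.Bundles using (_⇔_; mk⇔; Equivalence)
open import Data.Nat.Induction using (<-rec)
open import Data.Empty using (⊥-elim)
open import Relation.Nullary using (¬_; Dec; yes; no)
open import Relation.Binary.PropositionalEquality hiding ([_])
open import Relation.Binary.Definitions using (tri<; tri≈; tri>)
open import Relation.Binary.Construct.Closure.ReflexiveTransitive using (ε; _◅_)
open import Data.Nat.Tactic.RingSolver using (solve-∀)
import Data.Integer.Tactic.RingSolver as ℤ-Solver

-- Indexing with default 0 past the end: for a Dyck path of size n the value
-- at n is then e_n = 0.
at : List ℕ → ℕ → ℕ
at [] i = 0
at (x ∷ xs) zero = x
at (x ∷ xs) (suc i) = at xs i

at-++ˡ : ∀ xs ys {i} → i < length xs → at (xs ++ ys) i ≡ at xs i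
at-++ˡ (x ∷ xs) ys {zero} _ = refl
at-++ˡ (x ∷ xs) ys {suc i} (s≤s i<) = at-++ˡ xs ys i<

at-++ʳ : ∀ xs ys t → at (xs ++ ys) (length xs + t) ≡ at ys t
at-++ʳ [] ys t = refl
at-++ʳ (x ∷ xs) ys t = at-++ʳ xs ys t

at-≥ : ∀ xs {i} → length xs ≤ i → at xs i ≡ 0
at-≥ [] _ = refl
at-≥ (x ∷ xs) {suc i} (s≤s l≤i) = at-≥ xs l≤i

at-map-suc : ∀ xs {t} → t < length xs → at (map suc xs) t ≡ suc (at xs t)
at-map-suc (x ∷ xs) {zero} _ = refl
at-map-suc (x ∷ xs) {suc t} (s≤s t<) = at-map-suc xs t<

at-++-[0] : ∀ xs i → at (xs ++ [ 0 ]) i ≡ at xs i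
at-++-[0] [] zero = refl
at-++-[0] [] (suc i) = refl
at-++-[0] (x ∷ xs) zero = refl
at-++-[0] (x ∷ xs) (suc i) = at-++-[0] xs i

at-extensional : ∀ xs ys → length xs ≡ length ys → (∀ i → i < length xs → at xs i ≡ at ys i) → xs ≡ ys
at-extensional [] [] _ _ = refl
at-extensional (x ∷ xs) (y ∷ ys) eq f =
  cong₂ _∷_ (f 0 (s≤s z≤n)) (at-extensional xs ys (suc-injective eq) (λ i i< → f (suc i) (s≤s i<)))

<⊎≡+ : ∀ a i → i < a ⊎ Σ ℕ (λ t → i ≡ a + t)
<⊎≡+ zero i = inj₂ (i , refl)
<⊎≡+ (suc a) zero = inj₁ (s≤s z≤n)
<⊎≡+ (suc a) (suc i) with <⊎≡+ a i
... | inj₁ i<a = inj₁ (s≤s i<a)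
... | inj₂ (t , refl) = inj₂ (t , refl)

from-offset : ∀ a {P : ℕ → Set} → (∀ t → P (a + t)) → ∀ {i} → a ≤ i → P i
from-offset a f a≤i with m≤n⇒∃[o]m+o≡n a≤i
... | t , refl = f t

≡⊎<<⊎≥ : ∀ {k K b} → k ≤ b → b ≡ k ⊎ (k < b × b < K) ⊎ K ≤ b
≡⊎<<⊎≥ {k} {K} {b} k≤b with m≤n⇒m<n∨m≡n k≤b | b <? K
... | inj₂ refl | _ = inj₁ refl
... | inj₁ k<b | yes b<K = inj₂ (inj₁ (k<b , b<K))
... | inj₁ k<b | no b≮K = inj₂ (inj₂ (≮⇒≥ b≮K))

last-below : (P : ℕ → Set) → (∀ i → Dec (P i)) → ∀ {a j} → a < j → P a →
  Σ ℕ λ c → a ≤ c × c < j × P c × (∀ r → c < r → r < j → ¬ P r)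
last-below P P? {a} {suc j} a<1+j Pa with P? j | m≤n⇒m<n∨m≡n (≤-pred a<1+j)
... | yes Pj | _ = j , ≤-pred a<1+j , n<1+n j , Pj , λ r j<r r<1+j → ⊥-elim (<⇒≱ j<r (≤-pred r<1+j))
... | no ¬Pj | inj₂ refl = ⊥-elim (¬Pj Pa)
... | no ¬Pj | inj₁ a<j with last-below P P? a<j Pa
...   | c , a≤c , c<j , Pc , after = c , a≤c , <-trans c<j (n<1+n j) , Pc , after′
  where
  after′ : ∀ r → c < r → r < suc j → ¬ P r
  after′ r c<r r<1+j with m≤n⇒m<n∨m≡n (≤-pred r<1+j)
  ... | inj₁ r<j = after r c<r r<j
  ... | inj₂ refl = ¬Pj

least-or-none : (P : ℕ → Set) → (∀ i → Dec (P i)) → ∀ n →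
  (∀ i → i ≤ n → ¬ P i) ⊎ Σ ℕ λ j → j ≤ n × P j × (∀ i → i < j → ¬ P i)
least-or-none P P? zero with P? 0
... | yes P0 = inj₂ (0 , z≤n , P0 , λ i ())
... | no ¬P0 = inj₁ λ { zero z≤n → ¬P0 }
least-or-none P P? (suc n) with least-or-none P P? n
... | inj₂ (j , j≤n , Pj , before) = inj₂ (j , ≤-trans j≤n (n≤1+n n) , Pj , before)
... | inj₁ none with P? (suc n)
...   | yes Pn = inj₂ (suc n , ≤-refl , Pn , λ i i<1+n → none i (≤-pred i<1+n))
...   | no ¬Pn = inj₁ none′
  where
  none′ : ∀ i → i ≤ suc n → ¬ P i
  none′ i i≤1+n with m≤n⇒m<n∨m≡n i≤1+n
  ... | inj₁ i<1+n = none i (≤-pred i<1+n)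
  ... | inj₂ refl = ¬Pn

-- Heights of a path

-- For a Dyck path P, at (heights 0 P) i is the height before its (i+1)-st N,
-- which is e_i(P) (e≡height); pred only truncates on words going below 0.
heights : ℕ → List Step → List ℕ
heights h [] = []
heights h (N ∷ w) = h ∷ heights (suc h) w
heights h (S ∷ w) = heights (pred h) w

final : ℕ → List Step → ℕ
final h [] = h
final h (N ∷ w) = final (suc h) w
final h (S ∷ w) = final (pred h) w

profile : ℕ → List Step → List ℕ
profile h w = heights h w ++ [ final h w ]

height : List Step → ℕ → ℕ
height w = at (heights 0 w)

#N #S : List Step → ℕ
#N [] = 0
#N (N ∷ w) = suc (#N w)
#N (S ∷ w) = #N w
#S [] = 0
#S (N ∷ w) = #S w
#S (S ∷ w) = suc (#S w)

heights-++ : ∀ h u v → heights h (u ++ v) ≡ heights h u ++ heights (final h u) v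
heights-++ h [] v = refl
heights-++ h (N ∷ u) v = cong (h ∷_) (heights-++ (suc h) u v)
heights-++ h (S ∷ u) v = heights-++ (pred h) u v

length-heights : ∀ h w → length (heights h w) ≡ #N w
length-heights h [] = refl
length-heights h (N ∷ w) = cong suc (length-heights (suc h) w)
length-heights h (S ∷ w) = length-heights (pred h) w

walk-++ : ∀ h u v {r} → walk h u ≡ just r → walk h (u ++ v) ≡ walk r v
walk-++ h [] v refl = refl
walk-++ h (N ∷ u) v wu = walk-++ (suc h) u v wu
walk-++ (suc h) (S ∷ u) v wu = walk-++ h u v wu

walk⇒final : ∀ h w {r} → walk h w ≡ just r → final h w ≡ r
walk⇒final h [] refl = refl
walk⇒final h (N ∷ w) ww = walk⇒final (suc h) w ww
walk⇒final (suc h) (S ∷ w) ww = walk⇒final h w ww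

walk⇒balance : ∀ h w {r} → walk h w ≡ just r → h + #N w ≡ r + #S w
walk⇒balance h [] refl = refl
walk⇒balance h (N ∷ w) ww = trans (+-suc h (#N w)) (walk⇒balance (suc h) w ww)
walk⇒balance (suc h) (S ∷ w) {r} ww = trans (cong suc (walk⇒balance h w ww)) (sym (+-suc r (#S w)))

length≡#N+#S : ∀ w → length w ≡ #N w + #S w
length≡#N+#S [] = refl
length≡#N+#S (N ∷ w) = cong suc (length≡#N+#S w)
length≡#N+#S (S ∷ w) = trans (cong suc (length≡#N+#S w)) (sym (+-suc (#N w) (#S w)))

m+m≡n+n⇒m≡n : ∀ {m n} → m + m ≡ n + n → m ≡ n
m+m≡n+n⇒m≡n {zero} {zero} _ = refl
m+m≡n+n⇒m≡n {suc m} {suc n} eq =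
  cong suc (m+m≡n+n⇒m≡n (suc-injective (trans (sym (+-suc m m)) (trans (suc-injective eq) (+-suc n n)))))

#N-dyck : ∀ {n} w → IsDyck n w → #N w ≡ n
#N-dyck {n} w (len , ww) = m+m≡n+n⇒m≡n (begin
  #N w + #N w ≡⟨ cong (#N w +_) (walk⇒balance 0 w ww) ⟩
  #N w + #S w ≡⟨ length≡#N+#S w ⟨
  length w    ≡⟨ len ⟩
  n + n       ∎)
  where open ≡-Reasoning

length-heights-dyck : ∀ {n} w → IsDyck n w → length (heights 0 w) ≡ n
length-heights-dyck w d = trans (length-heights 0 w) (#N-dyck w d)

height≡0 : ∀ {n} w → IsDyck n w → ∀ {i} → n ≤ i → height w i ≡ 0
height≡0 w d n≤i = at-≥ (heights 0 w) (subst (_≤ _) (sym (length-heights-dyck w d)) n≤i)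

head-profile≤ : ∀ h w → at (profile h w) 0 ≤ h
head-profile≤ h [] = ≤-refl
head-profile≤ h (N ∷ w) = ≤-refl
head-profile≤ h (S ∷ w) = ≤-trans (head-profile≤ (pred h) w) pred[n]≤n

head-heights≤ : ∀ h w → at (heights h w) 0 ≤ h
head-heights≤ h [] = z≤n
head-heights≤ h (N ∷ w) = ≤-refl
head-heights≤ h (S ∷ w) = ≤-trans (head-heights≤ (pred h) w) pred[n]≤n

heights-step : ∀ h w k → at (heights h w) (suc k) ≤ suc (at (heights h w) k)
heights-step h [] k = z≤n
heights-step h (N ∷ w) zero = head-heights≤ (suc h) w
heights-step h (N ∷ w) (suc k) = heights-step (suc h) w k
heights-step h (S ∷ w) k = heights-step (pred h) w k

S-after-start : ∀ h v {xs} → suc h ∷ xs ≢ profile h v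
S-after-start h v eq = 1+n≰n (≤-trans (≤-reflexive (cong (λ l → at l 0) eq)) (head-profile≤ h v))

-- The head of the profile is below h exactly when the path starts with S.
profile-injective : ∀ h u v {r s} → walk h u ≡ just r → walk h v ≡ just s →
  profile h u ≡ profile h v → u ≡ v
profile-injective h [] [] _ _ _ = refl
profile-injective h [] (N ∷ v) _ _ eq with ++-conicalʳ (heights (suc h) v) _ (sym (∷-injectiveʳ eq))
... | ()
profile-injective (suc h) [] (S ∷ v) _ _ eq = ⊥-elim (S-after-start h v eq)
profile-injective h (N ∷ u) [] wu wv eq = sym (profile-injective h [] (N ∷ u) wv wu (sym eq))
profile-injective (suc h) (S ∷ u) [] wu wv eq = sym (profile-injective (suc h) [] (S ∷ u) wv wu (sym eq))
profile-injective h (N ∷ u) (N ∷ v) wu wv eq = cong (N ∷_) (profile-injective (suc h) u v wu wv (∷-injectiveʳ eq))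
profile-injective (suc h) (N ∷ u) (S ∷ v) _ _ eq = ⊥-elim (S-after-start h v eq)
profile-injective (suc h) (S ∷ u) (N ∷ v) wu wv eq = sym (profile-injective (suc h) (N ∷ v) (S ∷ u) wv wu (sym eq))
profile-injective (suc h) (S ∷ u) (S ∷ v) wu wv eq = cong (S ∷_) (profile-injective h u v wu wv eq)

heights-injective : ∀ h u v {r} → walk h u ≡ just r → walk h v ≡ just r → heights h u ≡ heights h v → u ≡ v
heights-injective h u v wu wv eq = profile-injective h u v wu wv
  (cong₂ (λ xs x → xs ++ [ x ]) eq (trans (walk⇒final h u wu) (sym (walk⇒final h v wv))))

profile-blocks : ∀ h w {r} → walk h w ≡ just r → ∀ i → i ≤ #N w →
  at (profile h w) i + proj₁ (blocks w) + sum (take i (alphas w)) ≡ h + i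
profile-blocks h [] _ zero _ = +-identityʳ (h + 0)
profile-blocks h (N ∷ w) _ zero _ = +-identityʳ (h + 0)
profile-blocks h (N ∷ w) ww (suc i) (s≤s i≤) = begin
  x + 0 + (a + s) ≡⟨ regroup x a s ⟩
  x + a + s       ≡⟨ profile-blocks (suc h) w ww i i≤ ⟩
  suc h + i       ≡⟨ +-suc h i ⟨
  h + suc i       ∎
  where
  open ≡-Reasoning
  x a s : ℕ
  x = at (profile (suc h) w) i
  a = proj₁ (blocks w)
  s = sum (take i (alphas w))
  regroup : ∀ x a s → x + 0 + (a + s) ≡ x + a + s
  regroup = solve-∀
profile-blocks (suc h) (S ∷ w) ww i i≤ =
  trans (+-suc-middle (at (profile h w) i) (proj₁ (blocks w)) (sum (take i (alphas w))))
        (cong suc (profile-blocks h w ww i i≤))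
  where
  +-suc-middle : ∀ x a s → x + suc a + s ≡ suc (x + a + s)
  +-suc-middle = solve-∀

no-leading-S : ∀ w {r} → walk 0 w ≡ just r → proj₁ (blocks w) ≡ 0
no-leading-S [] _ = refl
no-leading-S (N ∷ w) _ = refl

e≡height : ∀ {n} w → IsDyck n w → ∀ {i} → i ≤ n → e i w ≡ ℤ.+ height w i
e≡height w d@(_ , ww) {i} i≤n = begin
  ℤ.+ i ℤ.- ℤ.+ s   ≡⟨ ℤₚ.[+m]-[+n]≡m⊖n i s ⟩
  i ⊖ s             ≡⟨ ℤₚ.⊖-≥ (subst (s ≤_) x+s≡i (m≤n+m s x)) ⟩
  ℤ.+ (i ∸ s)       ≡⟨ cong (λ j → ℤ.+ (j ∸ s)) x+s≡i ⟨
  ℤ.+ (x + s ∸ s)   ≡⟨ cong ℤ.+_ (m+n∸n≡m x s) ⟩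
  ℤ.+ x             ∎
  where
  open ≡-Reasoning
  s x : ℕ
  s = sum (take i (alphas w))
  x = height w i
  profile≡height : at (profile 0 w) i ≡ x
  profile≡height = trans (cong (λ z → at (heights 0 w ++ [ z ]) i) (walk⇒final 0 w ww)) (at-++-[0] (heights 0 w) i)
  x+s≡i : x + s ≡ i
  x+s≡i = begin
    x + s ≡⟨ cong (_+ s) (+-identityʳ x) ⟨
    x + 0 + s ≡⟨ cong₂ (λ y a → y + a + s) profile≡height (no-leading-S w ww) ⟨
    at (profile 0 w) i + proj₁ (blocks w) + s ≡⟨ profile-blocks 0 w ww i (subst (i ≤_) (sym (#N-dyck w d)) i≤n) ⟩
    i ∎

walk-σ : ∀ h B → walk h (σ B) ≡ just h
walk-σ h leaf = refl
walk-σ h (bin B₁ B₂) =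
  trans (walk-++ h (σ B₁) _ (walk-σ h B₁)) (walk-++ (suc h) (σ B₂) [ S ] (walk-σ (suc h) B₂))

final-σ : ∀ h B → final h (σ B) ≡ h
final-σ h B = walk⇒final h (σ B) (walk-σ h B)

heights-σ-bin : ∀ h B₁ B₂ → heights h (σ (bin B₁ B₂)) ≡ heights h (σ B₁) ++ h ∷ heights (suc h) (σ B₂)
heights-σ-bin h B₁ B₂ = begin
  heights h (σ B₁ ++ N ∷ σ B₂ ++ [ S ])
    ≡⟨ heights-++ h (σ B₁) _ ⟩
  heights h (σ B₁) ++ heights (final h (σ B₁)) (N ∷ σ B₂ ++ [ S ])
    ≡⟨ cong (λ z → heights h (σ B₁) ++ heights z (N ∷ σ B₂ ++ [ S ])) (final-σ h B₁) ⟩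
  heights h (σ B₁) ++ h ∷ heights (suc h) (σ B₂ ++ [ S ])
    ≡⟨ cong (λ z → heights h (σ B₁) ++ h ∷ z) (heights-++ (suc h) (σ B₂) [ S ]) ⟩
  heights h (σ B₁) ++ h ∷ (heights (suc h) (σ B₂) ++ [])
    ≡⟨ cong (λ z → heights h (σ B₁) ++ h ∷ z) (++-identityʳ _) ⟩
  heights h (σ B₁) ++ h ∷ heights (suc h) (σ B₂) ∎
  where open ≡-Reasoning

heights-σ-suc : ∀ h B → heights (suc h) (σ B) ≡ map suc (heights h (σ B))
heights-σ-suc h leaf = refl
heights-σ-suc h (bin B₁ B₂) = begin
  heights (suc h) (σ (bin B₁ B₂))
    ≡⟨ heights-σ-bin (suc h) B₁ B₂ ⟩
  heights (suc h) (σ B₁) ++ suc h ∷ heights (suc (suc h)) (σ B₂)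
    ≡⟨ cong₂ (λ xs ys → xs ++ suc h ∷ ys) (heights-σ-suc h B₁) (heights-σ-suc (suc h) B₂) ⟩
  map suc (heights h (σ B₁)) ++ suc h ∷ map suc (heights (suc h) (σ B₂))
    ≡⟨ map-++ suc (heights h (σ B₁)) _ ⟨
  map suc (heights h (σ B₁) ++ h ∷ heights (suc h) (σ B₂))
    ≡⟨ cong (map suc) (heights-σ-bin h B₁ B₂) ⟨
  map suc (heights h (σ (bin B₁ B₂))) ∎
  where open ≡-Reasoning

treeHeights : BTree → List ℕ
treeHeights B = heights 0 (σ B)

treeHeights-bin : ∀ B₁ B₂ → treeHeights (bin B₁ B₂) ≡ treeHeights B₁ ++ 0 ∷ map suc (treeHeights B₂)
treeHeights-bin B₁ B₂ = trans (heights-σ-bin 0 B₁ B₂) (cong (λ z → treeHeights B₁ ++ 0 ∷ z) (heights-σ-suc 0 B₂))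

walk-ωs : ∀ h ts → walk h (ωs ts) ≡ just h
walk-ωs h [] = refl
walk-ωs h (node cs ∷ ts) = trans (walk-++ (suc h) (ωs cs) _ (walk-ωs (suc h) cs)) (walk-ωs h ts)

final-ωs : ∀ h ts → final h (ωs ts) ≡ h
final-ωs h ts = walk⇒final h (ωs ts) (walk-ωs h ts)

heights-ωs-∷ : ∀ h cs ts → heights h (ωs (node cs ∷ ts)) ≡ h ∷ heights (suc h) (ωs cs) ++ heights h (ωs ts)
heights-ωs-∷ h cs ts = cong (h ∷_) (trans (heights-++ (suc h) (ωs cs) (S ∷ ωs ts))
  (cong (λ z → heights (suc h) (ωs cs) ++ heights z (S ∷ ωs ts)) (final-ωs (suc h) cs)))

heights-ωs-≥ : ∀ h ts {i} → i < length (heights h (ωs ts)) → h ≤ at (heights h (ωs ts)) i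
heights-ωs-≥ h (node cs ∷ ts) {i} i< =
  subst (λ xs → h ≤ at xs i) (sym (heights-ωs-∷ h cs ts))
    (≥-head-++ i (subst (λ xs → i < length xs) (heights-ωs-∷ h cs ts) i<))
  where
  A B : List ℕ
  A = heights (suc h) (ωs cs)
  B = heights h (ωs ts)
  ≥-head-++ : ∀ i → i < length (h ∷ A ++ B) → h ≤ at (h ∷ A ++ B) i
  ≥-head-++ zero _ = ≤-refl
  ≥-head-++ (suc i) (s≤s i<) with <⊎≡+ (length A) i
  ... | inj₁ i<A = subst (h ≤_) (sym (at-++ˡ A B i<A)) (≤-trans (n≤1+n h) (heights-ωs-≥ (suc h) cs i<A))
  ... | inj₂ (t , refl) = subst (h ≤_) (sym (at-++ʳ A B t))
    (heights-ωs-≥ h ts (+-cancelˡ-< (length A) t _ (subst (length A + t <_) (length-++ A) i<)))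

toBinary : BTree → List PTree → BTree
toBinary acc [] = acc
toBinary acc (node cs ∷ ts) = toBinary (bin acc (toBinary leaf cs)) ts

σ-toBinary : ∀ acc ts → σ (toBinary acc ts) ≡ σ acc ++ ωs ts
σ-toBinary acc [] = sym (++-identityʳ _)
σ-toBinary acc (node cs ∷ ts) = begin
  σ (toBinary (bin acc (toBinary leaf cs)) ts)      ≡⟨ σ-toBinary _ ts ⟩
  (σ acc ++ N ∷ σ (toBinary leaf cs) ++ [ S ]) ++ ωs ts
    ≡⟨ cong (λ z → (σ acc ++ N ∷ z ++ [ S ]) ++ ωs ts) (σ-toBinary leaf cs) ⟩
  (σ acc ++ N ∷ ωs cs ++ [ S ]) ++ ωs ts           ≡⟨ ++-assoc (σ acc) _ _ ⟩
  σ acc ++ N ∷ (ωs cs ++ [ S ]) ++ ωs ts           ≡⟨ cong (λ z → σ acc ++ N ∷ z) (++-assoc (ωs cs) _ _) ⟩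
  σ acc ++ N ∷ ωs cs ++ S ∷ ωs ts                  ∎
  where open ≡-Reasoning

binaryOf : PTree → BTree
binaryOf (node ts) = toBinary leaf ts

σ-binaryOf : ∀ T → σ (binaryOf T) ≡ ω T
σ-binaryOf (node ts) = σ-toBinary leaf ts

-- u_k is first visited by the N step of ω T with index k (from 0), at depth
-- E k + 1; so u_a is the parent of u_b iff u_b is one level deeper than u_a and
-- every vertex first visited in between is deeper than u_a.
IsParent : (ℕ → ℕ) → ℕ → ℕ → Set
IsParent E a b = a < b × suc (E a) ≡ E b × (∀ k → a < k → k < b → E a < E k)

Segment : List ℕ → ℕ → List ℕ → Set
Segment L k xs = ∀ i → i < length xs → at L (k + i) ≡ at xs i

segment-head : ∀ L k {x xs} → Segment L k (x ∷ xs) → at L k ≡ x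
segment-head L k seg = trans (cong (at L) (sym (+-identityʳ k))) (seg 0 (s≤s z≤n))

segment-tail : ∀ L k {x xs} → Segment L k (x ∷ xs) → Segment L (suc k) xs
segment-tail L k seg i i< = trans (cong (at L) (sym (+-suc k i))) (seg (suc i) (s≤s i<))

segment-++ˡ : ∀ L k xs {ys} → Segment L k (xs ++ ys) → Segment L k xs
segment-++ˡ L k xs {ys} seg i i< =
  trans (seg i (<-≤-trans i< (subst (length xs ≤_) (sym (length-++ xs)) (m≤m+n _ _)))) (at-++ˡ xs ys i<)

segment-++ʳ : ∀ L k xs {ys} → Segment L k (xs ++ ys) → Segment L (k + length xs) ys
segment-++ʳ L k xs {ys} seg i i< = begin
  at L (k + length xs + i)   ≡⟨ cong (at L) (+-assoc k (length xs) i) ⟩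
  at L (k + (length xs + i)) ≡⟨ seg (length xs + i) (subst (length xs + i <_) (sym (length-++ xs)) (+-monoʳ-< (length xs) i<)) ⟩
  at (xs ++ ys) (length xs + i) ≡⟨ at-++ʳ xs ys i ⟩
  at ys i ∎
  where open ≡-Reasoning

-- The label p that goCh carries on reaching label k is the parent of a vertex
-- of height h (so depth h + 1) at index k; nothing stands for the root.
ParentContext : List ℕ → Maybe ℕ → ℕ → ℕ → Set
ParentContext L nothing k h = h ≡ 0
ParentContext L (just q) k h = q < k × suc (at L q) ≡ h × (∀ r → q < r → r < k → h ≤ at L r)

ParentContext-extend : ∀ L p {k K h} → ParentContext L p k h → k < K →
  (∀ r → k ≤ r → r < K → h ≤ at L r) → ParentContext L p K h
ParentContext-extend L nothing ctx _ _ = ctx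
ParentContext-extend L (just q) {k} {K} {h} (q<k , eq , above) k<K above′ = <-trans q<k k<K , eq , above″
  where
  above″ : ∀ r → q < r → r < K → h ≤ at L r
  above″ r q<r r<K with r <? k
  ... | yes r<k = above r q<r r<k
  ... | no r≮k = above′ r (≮⇒≥ r≮k) r<K

edgeTo-sound : ∀ L p {k h a b} → ParentContext L p k h → at L k ≡ h →
  (a , b) ∈ edgeTo p k → b ≡ k × IsParent (at L) a b
edgeTo-sound L (just q) (q<k , eq , above) Lk≡h (here refl) =
  refl , q<k , trans eq (sym Lk≡h) , λ r q<r r<k → subst (_≤ at L r) (sym eq) (above r q<r r<k)

edgeTo-complete : ∀ L p {k h a} → ParentContext L p k h → at L k ≡ h →
  IsParent (at L) a k → (a , k) ∈ edgeTo p k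
edgeTo-complete L nothing h≡0 Lk≡h (_ , eq , _) = ⊥-elim (0≢1+n (sym (trans eq (trans Lk≡h h≡0))))
edgeTo-complete L (just q) (q<k , eq , above) Lk≡h (a<k , eq′ , below) with <-cmp _ q
... | tri< a<q _ _ = ⊥-elim (<-irrefl (suc-injective (trans eq′ (trans Lk≡h (sym eq)))) (below q a<q q<k))
... | tri≈ _ refl _ = here refl
... | tri> _ _ q<a = ⊥-elim (<⇒≱ (≤-reflexive (trans eq′ Lk≡h)) (above _ q<a a<k))

#N-++ : ∀ u v → #N (u ++ v) ≡ #N u + #N v
#N-++ [] v = refl
#N-++ (N ∷ u) v = cong suc (#N-++ u v)
#N-++ (S ∷ u) v = #N-++ u v

goCh-next : ∀ p k ts → proj₂ (goCh p k ts) ≡ k + #N (ωs ts)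
goCh-next p k [] = sym (+-identityʳ k)
goCh-next p k (node cs ∷ ts) = begin
  proj₂ (goCh p (proj₂ (goCh (just k) (suc k) cs)) ts) ≡⟨ goCh-next p _ ts ⟩
  proj₂ (goCh (just k) (suc k) cs) + #N (ωs ts)     ≡⟨ cong (_+ #N (ωs ts)) (goCh-next (just k) (suc k) cs) ⟩
  suc k + #N (ωs cs) + #N (ωs ts)                    ≡⟨ cong suc (+-assoc k _ _) ⟩
  suc (k + (#N (ωs cs) + #N (ωs ts)))                ≡⟨ +-suc k _ ⟨
  k + suc (#N (ωs cs) + #N (ωs ts))                  ≡⟨ cong (λ x → k + suc x) (#N-++ (ωs cs) (S ∷ ωs ts)) ⟨
  k + #N (ωs (node cs ∷ ts))                         ∎
  where open ≡-Reasoning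

module Descend (L : List ℕ) (p : Maybe ℕ) (k h : ℕ) (cs ts : List PTree)
  (seg : Segment L k (heights h (ωs (node cs ∷ ts)))) (ctx : ParentContext L p k h) where

  A : List ℕ
  A = heights (suc h) (ωs cs)
  K : ℕ
  K = proj₂ (goCh (just k) (suc k) cs)

  K≡ : K ≡ suc k + #N (ωs cs)
  K≡ = goCh-next (just k) (suc k) cs

  end≡ : k + #N (ωs (node cs ∷ ts)) ≡ K + #N (ωs ts)
  end≡ = trans (sym (goCh-next p k (node cs ∷ ts))) (goCh-next p K ts)

  seg′ : Segment L k (h ∷ A ++ heights h (ωs ts))
  seg′ = subst (Segment L k) (heights-ωs-∷ h cs ts) seg

  root-height : at L k ≡ h
  root-height = segment-head L k seg′

  child-segment : Segment L (suc k) A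
  child-segment = segment-++ˡ L (suc k) A (segment-tail L k seg′)

  child-context : ParentContext L (just k) (suc k) (suc h)
  child-context = n<1+n k , cong suc root-height , λ r k<r r<1+k → ⊥-elim (<⇒≱ k<r (≤-pred r<1+k))

  sibling-segment : Segment L K (heights h (ωs ts))
  sibling-segment = subst (λ K → Segment L K (heights h (ωs ts)))
    (trans (cong (suc k +_) (length-heights (suc h) (ωs cs))) (sym K≡))
    (segment-++ʳ L (suc k) A {heights h (ωs ts)} (segment-tail L k seg′))

  sibling-context : ParentContext L p K h
  sibling-context = ParentContext-extend L p ctx (subst (k <_) (sym K≡) (s≤s (m≤m+n k _))) high
    where
    high : ∀ r → k ≤ r → r < K → h ≤ at L r
    high r k≤r r<K with <⊎≡+ (suc k) r
    ... | inj₁ r<1+k = subst (h ≤_) (cong (at L) (≤-antisym k≤r (≤-pred r<1+k))) (≤-reflexive (sym root-height))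
    ... | inj₂ (t , refl) = ≤-trans (n≤1+n h) (subst (suc h ≤_) (sym (child-segment t t<A)) (heights-ωs-≥ (suc h) cs t<A))
      where
      t<A : t < length A
      t<A = subst (t <_) (sym (length-heights (suc h) (ωs cs))) (+-cancelˡ-< (suc k) t _ (subst (suc k + t <_) K≡ r<K))

goCh-sound : ∀ L p k h ts → Segment L k (heights h (ωs ts)) → ParentContext L p k h →
  ∀ {a b} → (a , b) ∈ proj₁ (goCh p k ts) → k ≤ b × b < k + #N (ωs ts) × IsParent (at L) a b
goCh-sound L p k h (node cs ∷ ts) seg ctx {a} {b} m =
  [ fromEdge , [ fromChild , fromSibling ]′ ∘ ∈-++⁻ _ ]′ (∈-++⁻ (edgeTo p k) m)
  where
  open Descend L p k h cs ts seg ctx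
  Goal : Set
  Goal = k ≤ b × b < k + #N (ωs (node cs ∷ ts)) × IsParent (at L) a b
  fromEdge : (a , b) ∈ edgeTo p k → Goal
  fromEdge m′ with edgeTo-sound L p ctx root-height m′
  ... | refl , par = ≤-refl , m<m+n k (s≤s z≤n) , par
  fromChild : (a , b) ∈ proj₁ (goCh (just k) (suc k) cs) → Goal
  fromChild m′ with goCh-sound L (just k) (suc k) (suc h) cs child-segment child-context m′
  ... | lo , hi , par =
    ≤-trans (n≤1+n k) lo , subst (b <_) (sym end≡) (<-≤-trans (subst (b <_) (sym K≡) hi) (m≤m+n K _)) , par
  fromSibling : (a , b) ∈ proj₁ (goCh p K ts) → Goal
  fromSibling m′ with goCh-sound L p K h ts sibling-segment sibling-context m′
  ... | lo , hi , par =
    ≤-trans (subst (k ≤_) (sym K≡) (≤-trans (n≤1+n k) (m≤m+n _ _))) lo , subst (b <_) (sym end≡) hi , par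

goCh-complete : ∀ L p k h ts → Segment L k (heights h (ωs ts)) → ParentContext L p k h →
  ∀ {a b} → k ≤ b → b < k + #N (ωs ts) → IsParent (at L) a b → (a , b) ∈ proj₁ (goCh p k ts)
goCh-complete L p k h [] seg ctx k≤b b< par = ⊥-elim (<⇒≱ b< (subst (_≤ _) (sym (+-identityʳ k)) k≤b))
goCh-complete L p k h (node cs ∷ ts) seg ctx {a} {b} k≤b b< par =
  [ atRoot , [ inChildren , inSiblings ]′ ]′ (≡⊎<<⊎≥ k≤b)
  where
  open Descend L p k h cs ts seg ctx
  Goal : Set
  Goal = (a , b) ∈ proj₁ (goCh p k (node cs ∷ ts))
  atRoot : b ≡ k → Goal
  atRoot refl = ∈-++⁺ˡ (edgeTo-complete L p ctx root-height par)
  inChildren : k < b × b < K → Goal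
  inChildren (k<b , b<K) = ∈-++⁺ʳ (edgeTo p k) (∈-++⁺ˡ
    (goCh-complete L (just k) (suc k) (suc h) cs child-segment child-context k<b (subst (b <_) K≡ b<K) par))
  inSiblings : K ≤ b → Goal
  inSiblings K≤b = ∈-++⁺ʳ (edgeTo p k) (∈-++⁺ʳ _
    (goCh-complete L p K h ts sibling-segment sibling-context K≤b (subst (b <_) end≡ b<) par))

parentPairs-sound : ∀ T {a b} → (a , b) ∈ parentPairs T → b < #N (ω T) × IsParent (height (ω T)) a b
parentPairs-sound (node ts) m with goCh-sound (heights 0 (ωs ts)) nothing 0 0 ts (λ _ _ → refl) refl m
... | _ , b< , par = b< , par

parentPairs-complete : ∀ T {a b} → b < #N (ω T) → IsParent (height (ω T)) a b → (a , b) ∈ parentPairs T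
parentPairs-complete (node ts) = goCh-complete (heights 0 (ωs ts)) nothing 0 0 ts (λ _ _ → refl) refl z≤n

-- Rotations as shifts of height sequences

-- The effect of a Tamari rotation on heights: E′ is E with the block [j, m)
-- raised by one, where E stays strictly above E j inside the block and is back
-- at or below E j at m (the block encodes a node and its right subtree).
record Shift (E E′ : ℕ → ℕ) (n j m : ℕ) : Set where
  field
    j<m      : j < m
    m≤n      : m ≤ n
    exit     : E m ≤ E j
    interior : ∀ k → j < k → k < m → E j < E k
    raised   : ∀ i → j ≤ i → i < m → E′ i ≡ suc (E i)
    fixedˡ   : ∀ i → i < j → E′ i ≡ E i
    fixedʳ   : ∀ i → m ≤ i → E′ i ≡ E i

record ListShift (xs ys : List ℕ) (j m : ℕ) : Set where
  constructor mkListShift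
  field
    shift   : Shift (at xs) (at ys) (length xs) j m
    length≡ : length ys ≡ length xs

at-map-suc-cong : ∀ xs ys {t} → length ys ≡ length xs → at ys t ≡ at xs t → at (map suc ys) t ≡ at (map suc xs) t
at-map-suc-cong xs ys {t} len eq with t <? length xs
... | yes t<xs = trans (at-map-suc ys (subst (t <_) (sym len) t<xs)) (trans (cong suc eq) (sym (at-map-suc xs t<xs)))
... | no t≮xs = trans (at-≥ (map suc ys) (subst (_≤ t) (sym (trans (length-map suc ys) len)) (≮⇒≥ t≮xs)))
                      (sym (at-≥ (map suc xs) (subst (_≤ t) (sym (length-map suc xs)) (≮⇒≥ t≮xs))))

shift-block : ∀ Z → ListShift (0 ∷ map suc Z) (map suc (0 ∷ map suc Z)) 0 (suc (length Z))
shift-block Z = mkListShift sh (length-map suc Y)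
  where
  Y : List ℕ
  Y = 0 ∷ map suc Z
  lenY : length Y ≡ suc (length Z)
  lenY = cong suc (length-map suc Z)
  beyond : ∀ ws → length ws ≡ suc (length Z) → ∀ {i} → suc (length Z) ≤ i → at ws i ≡ 0
  beyond ws len m≤i = at-≥ ws (subst (_≤ _) (sym len) m≤i)
  interior′ : ∀ k → 0 < k → k < suc (length Z) → 0 < at Y k
  interior′ (suc t) _ (s≤s t<Z) = subst (0 <_) (sym (at-map-suc Z t<Z)) (s≤s z≤n)
  sh : Shift (at Y) (at (map suc Y)) (length Y) 0 (suc (length Z))
  sh = record
    { j<m      = s≤s z≤n
    ; m≤n      = ≤-reflexive (sym lenY)
    ; exit     = subst (_≤ 0) (sym (beyond Y lenY ≤-refl)) z≤n
    ; interior = interior′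
    ; raised   = λ i _ i<m → at-map-suc Y (subst (i <_) (sym lenY) i<m)
    ; fixedˡ   = λ i ()
    ; fixedʳ   = λ i m≤i → trans (beyond (map suc Y) (trans (length-map suc Y) lenY) m≤i) (sym (beyond Y lenY m≤i))
    }

shift-map-suc : ∀ {xs ys j m} → ListShift xs ys j m → ListShift (map suc xs) (map suc ys) j m
shift-map-suc {xs} {ys} {j} {m} (mkListShift sh len) =
  mkListShift sh′ (trans (length-map suc ys) (trans len (sym (length-map suc xs))))
  where
  open Shift sh
  inside : ∀ {i} → i < m → i < length xs
  inside i<m = <-≤-trans i<m m≤n
  sx : ∀ {i} → i < m → at (map suc xs) i ≡ suc (at xs i)
  sx i<m = at-map-suc xs (inside i<m)
  sy : ∀ {i} → i < m → at (map suc ys) i ≡ suc (at ys i)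
  sy i<m = at-map-suc ys (subst (_ <_) (sym len) (inside i<m))
  exit′ : at (map suc xs) m ≤ at (map suc xs) j
  exit′ with m≤n⇒m<n∨m≡n m≤n
  ... | inj₁ m<xs = subst₂ _≤_ (sym (at-map-suc xs m<xs)) (sym (sx j<m)) (s≤s exit)
  ... | inj₂ refl = subst (_≤ at (map suc xs) j) (sym (at-≥ (map suc xs) (≤-reflexive (length-map suc xs)))) z≤n
  sh′ : Shift (at (map suc xs)) (at (map suc ys)) (length (map suc xs)) j m
  sh′ = record
    { j<m      = j<m
    ; m≤n      = subst (m ≤_) (sym (length-map suc xs)) m≤n
    ; exit     = exit′
    ; interior = λ k j<k k<m → subst₂ _<_ (sym (sx j<m)) (sym (sx k<m)) (s≤s (interior k j<k k<m))
    ; raised   = λ i j≤i i<m → trans (sy i<m) (trans (cong suc (raised i j≤i i<m)) (cong suc (sym (sx i<m))))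
    ; fixedˡ   = λ i i<j → at-map-suc-cong xs ys len (fixedˡ i i<j)
    ; fixedʳ   = λ i m≤i → at-map-suc-cong xs ys len (fixedʳ i m≤i)
    }

shift-++ˡ : ∀ W {xs ys j m} → ListShift xs ys j m → ListShift (W ++ xs) (W ++ ys) (length W + j) (length W + m)
shift-++ˡ W {xs} {ys} {j} {m} (mkListShift sh len) =
  mkListShift sh′ (trans (length-++ W) (trans (cong (a +_) len) (sym (length-++ W))))
  where
  open Shift sh
  a : ℕ
  a = length W
  X Y : ℕ → ℕ
  X = at (W ++ xs)
  Y = at (W ++ ys)
  sx : ∀ t → X (a + t) ≡ at xs t
  sx = at-++ʳ W xs
  sy : ∀ t → Y (a + t) ≡ at ys t
  sy = at-++ʳ W ys
  a≤ : ∀ {i} → a + j ≤ i → a ≤ i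
  a≤ = ≤-trans (m≤m+n a j)
  fixedˡ′ : ∀ i → i < a + j → Y i ≡ X i
  fixedˡ′ i i<j with <⊎≡+ a i
  ... | inj₁ i<a = trans (at-++ˡ W ys i<a) (sym (at-++ˡ W xs i<a))
  ... | inj₂ (t , refl) = trans (sy t) (trans (fixedˡ t (+-cancelˡ-< a t j i<j)) (sym (sx t)))
  sh′ : Shift X Y (length (W ++ xs)) (a + j) (a + m)
  sh′ = record
    { j<m      = +-monoʳ-< a j<m
    ; m≤n      = subst (a + m ≤_) (sym (length-++ W)) (+-monoʳ-≤ a m≤n)
    ; exit     = subst₂ _≤_ (sym (sx m)) (sym (sx j)) exit
    ; interior = λ k j<k → from-offset a {λ k → a + j < k → k < a + m → X (a + j) < X k}
        (λ t j<t t<m → subst₂ _<_ (sym (sx j)) (sym (sx t)) (interior t (+-cancelˡ-< a j t j<t) (+-cancelˡ-< a t m t<m)))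
        (a≤ (<⇒≤ j<k)) j<k
    ; raised   = λ i j≤i → from-offset a {λ i → a + j ≤ i → i < a + m → Y i ≡ suc (X i)}
        (λ t j≤t t<m → trans (sy t)
          (trans (raised t (+-cancelˡ-≤ a j t j≤t) (+-cancelˡ-< a t m t<m)) (cong suc (sym (sx t)))))
        (a≤ j≤i) j≤i
    ; fixedˡ   = fixedˡ′
    ; fixedʳ   = λ i m≤i → from-offset a {λ i → a + m ≤ i → Y i ≡ X i}
        (λ t m≤t → trans (sy t) (trans (fixedʳ t (+-cancelˡ-≤ a m t m≤t)) (sym (sx t))))
        (≤-trans (m≤m+n a m) m≤i) m≤i
    }

shift-++ʳ : ∀ {xs ys j m} Z → ListShift xs ys j m → ListShift (xs ++ 0 ∷ Z) (ys ++ 0 ∷ Z) j m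
shift-++ʳ {xs} {ys} {j} {m} Z (mkListShift sh len) =
  mkListShift sh′ (trans (length-++ ys) (trans (cong (_+ length (0 ∷ Z)) len) (sym (length-++ xs))))
  where
  open Shift sh
  X Y : ℕ → ℕ
  X = at (xs ++ 0 ∷ Z)
  Y = at (ys ++ 0 ∷ Z)
  inside : ∀ {i} → i < m → i < length xs
  inside i<m = <-≤-trans i<m m≤n
  sx : ∀ {i} → i < length xs → X i ≡ at xs i
  sx = at-++ˡ xs (0 ∷ Z)
  sy : ∀ {i} → i < length xs → Y i ≡ at ys i
  sy i< = at-++ˡ ys (0 ∷ Z) (subst (_ <_) (sym len) i<)
  exit′ : X m ≤ X j
  exit′ with m≤n⇒m<n∨m≡n m≤n
  ... | inj₁ m<xs = subst₂ _≤_ (sym (sx m<xs)) (sym (sx (inside j<m))) exit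
  ... | inj₂ refl = subst (_≤ X j) (sym (trans (cong X (sym (+-identityʳ m))) (at-++ʳ xs (0 ∷ Z) 0))) z≤n
  fixedʳ′ : ∀ i → m ≤ i → Y i ≡ X i
  fixedʳ′ i m≤i with <⊎≡+ (length xs) i
  ... | inj₁ i<xs = trans (sy i<xs) (trans (fixedʳ i m≤i) (sym (sx i<xs)))
  ... | inj₂ (t , refl) = trans (cong (λ l → Y (l + t)) (sym len)) (trans (at-++ʳ ys _ t) (sym (at-++ʳ xs _ t)))
  sh′ : Shift X Y (length (xs ++ 0 ∷ Z)) j m
  sh′ = record
    { j<m      = j<m
    ; m≤n      = ≤-trans m≤n (subst (length xs ≤_) (sym (length-++ xs)) (m≤m+n _ _))
    ; exit     = exit′
    ; interior = λ k j<k k<m → subst₂ _<_ (sym (sx (inside j<m))) (sym (sx (inside k<m))) (interior k j<k k<m)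
    ; raised   = λ i j≤i i<m → trans (sy (inside i<m)) (trans (raised i j≤i i<m) (cong suc (sym (sx (inside i<m)))))
    ; fixedˡ   = λ i i<j → let i<xs = inside (<-trans i<j j<m) in trans (sy i<xs) (trans (fixedˡ i i<j) (sym (sx i<xs)))
    ; fixedʳ   = fixedʳ′
    }

treeHeights-bin-assoc : ∀ A B → treeHeights (bin A B) ≡ (treeHeights A ++ [ 0 ]) ++ map suc (treeHeights B)
treeHeights-bin-assoc A B = trans (treeHeights-bin A B) (sym (++-assoc (treeHeights A) [ 0 ] _))

treeHeights-bin-right : ∀ B₁ B₂ B₃ →
  treeHeights (bin B₁ (bin B₂ B₃)) ≡ treeHeights (bin B₁ B₂) ++ map suc (0 ∷ map suc (treeHeights B₃))
treeHeights-bin-right B₁ B₂ B₃ = begin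
  treeHeights (bin B₁ (bin B₂ B₃))
    ≡⟨ treeHeights-bin B₁ (bin B₂ B₃) ⟩
  L₁ ++ 0 ∷ map suc (treeHeights (bin B₂ B₃))
    ≡⟨ cong (λ z → L₁ ++ 0 ∷ map suc z) (treeHeights-bin B₂ B₃) ⟩
  L₁ ++ 0 ∷ map suc (treeHeights B₂ ++ 0 ∷ map suc L₃)
    ≡⟨ cong (λ z → L₁ ++ 0 ∷ z) (map-++ suc (treeHeights B₂) _) ⟩
  L₁ ++ 0 ∷ (map suc (treeHeights B₂) ++ Y)
    ≡⟨ ++-assoc L₁ (0 ∷ map suc (treeHeights B₂)) Y ⟨
  (L₁ ++ 0 ∷ map suc (treeHeights B₂)) ++ Y
    ≡⟨ cong (_++ Y) (treeHeights-bin B₁ B₂) ⟨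
  treeHeights (bin B₁ B₂) ++ Y ∎
  where
  open ≡-Reasoning
  L₁ L₃ Y : List ℕ
  L₁ = treeHeights B₁
  L₃ = treeHeights B₃
  Y = map suc (0 ∷ map suc L₃)

rotate-at-root : ∀ B₁ B₂ B₃ → ListShift (treeHeights (bin (bin B₁ B₂) B₃)) (treeHeights (bin B₁ (bin B₂ B₃)))
  (length (treeHeights (bin B₁ B₂)) + 0) (length (treeHeights (bin B₁ B₂)) + suc (length (treeHeights B₃)))
rotate-at-root B₁ B₂ B₃ = subst₂ (λ u v → ListShift u v (a + 0) (a + suc (length (treeHeights B₃))))
  (sym (treeHeights-bin (bin B₁ B₂) B₃)) (sym (treeHeights-bin-right B₁ B₂ B₃))
  (shift-++ˡ (treeHeights (bin B₁ B₂)) (shift-block (treeHeights B₃)))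
  where
  a : ℕ
  a = length (treeHeights (bin B₁ B₂))

Rot⇒Shift : ∀ {B C} → Rot B C → Σ ℕ λ j → Σ ℕ λ m → ListShift (treeHeights B) (treeHeights C) j m
Rot⇒Shift (rot B₁ B₂ B₃) = _ , _ , rotate-at-root B₁ B₂ B₃
Rot⇒Shift (left {A} {A′} {B} r) with Rot⇒Shift r
... | j , m , sh = j , m , subst₂ (λ u v → ListShift u v j m)
  (sym (treeHeights-bin A B)) (sym (treeHeights-bin A′ B)) (shift-++ʳ _ sh)
Rot⇒Shift (right {A} {B} {B′} r) with Rot⇒Shift r
... | j , m , sh = _ , _ , subst₂ (λ u v → ListShift u v _ _)
  (sym (treeHeights-bin-assoc A B)) (sym (treeHeights-bin-assoc A B′)) (shift-++ˡ (treeHeights A ++ [ 0 ]) (shift-map-suc sh))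

descent-++ˡ : ∀ xs ys {j₀} → suc j₀ < length xs →
  at (xs ++ ys) (suc j₀) ≤ at (xs ++ ys) j₀ → at xs (suc j₀) ≤ at xs j₀
descent-++ˡ xs ys j<xs = subst₂ _≤_ (at-++ˡ xs ys j<xs) (at-++ˡ xs ys (<-trans (n<1+n _) j<xs))

descent-++-map-suc : ∀ P ys {t} → suc (length P + t) < length (P ++ map suc ys) →
  at (P ++ map suc ys) (suc (length P + t)) ≤ at (P ++ map suc ys) (length P + t) →
  suc t < length ys × at ys (suc t) ≤ at ys t
descent-++-map-suc P ys {t} j<len desc = t<ys , ≤-pred (subst₂ _≤_ at-suc-t at-t desc)
  where
  a : ℕ
  a = length P
  t<ys : suc t < length ys
  t<ys = +-cancelˡ-< a (suc t) _ (subst₂ _<_ (sym (+-suc a t)) (trans (length-++ P) (cong (a +_) (length-map suc ys))) j<len)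
  at-suc-t : at (P ++ map suc ys) (suc (a + t)) ≡ suc (at ys (suc t))
  at-suc-t = trans (cong (at (P ++ map suc ys)) (sym (+-suc a t))) (trans (at-++ʳ P _ (suc t)) (at-map-suc ys t<ys))
  at-t : at (P ++ map suc ys) (a + t) ≡ suc (at ys t)
  at-t = trans (at-++ʳ P _ t) (at-map-suc ys (<-trans (n<1+n t) t<ys))

no-descent-after-root : ∀ xs ys → suc (length xs) < length (xs ++ 0 ∷ map suc ys) →
  ¬ at (xs ++ 0 ∷ map suc ys) (suc (length xs)) ≤ at (xs ++ 0 ∷ map suc ys) (length xs)
no-descent-after-root xs [] j<len _ = <-irrefl (sym len≡) j<len
  where len≡ : length (xs ++ [ 0 ]) ≡ suc (length xs)
        len≡ = trans (length-++ xs) (+-comm (length xs) 1)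
no-descent-after-root xs (y ∷ ys) _ desc = n≮0 (subst₂ _≤_ at-next at-root desc)
  where
  at-next : at (xs ++ 0 ∷ map suc (y ∷ ys)) (suc (length xs)) ≡ suc y
  at-next = trans (cong (at (xs ++ _)) (+-comm 1 (length xs))) (at-++ʳ xs _ 1)
  at-root : at (xs ++ 0 ∷ map suc (y ∷ ys)) (length xs) ≡ 0
  at-root = trans (cong (at (xs ++ _)) (sym (+-identityʳ (length xs)))) (at-++ʳ xs _ 0)

RotationWithShift : BTree → ℕ → Set
RotationWithShift B j = Σ BTree λ C → Σ ℕ λ m → Rot B C × ListShift (treeHeights B) (treeHeights C) j m

rotation-at-root : ∀ B₁ B₂ {j₀} → suc j₀ ≡ length (treeHeights B₁) → RotationWithShift (bin B₁ B₂) (suc j₀)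
rotation-at-root leaf B₂ ()
rotation-at-root (bin B₁₁ B₁₂) B₂ j≡ = bin B₁₁ (bin B₁₂ B₂) , m , rot B₁₁ B₁₂ B₂ ,
  subst (λ j → ListShift (treeHeights (bin (bin B₁₁ B₁₂) B₂)) (treeHeights (bin B₁₁ (bin B₁₂ B₂))) j m)
    (trans (+-identityʳ _) (sym j≡)) (rotate-at-root B₁₁ B₁₂ B₂)
  where m = length (treeHeights (bin B₁₁ B₁₂)) + suc (length (treeHeights B₂))

descent⇒Rot : ∀ B j₀ → suc j₀ < length (treeHeights B) →
  at (treeHeights B) (suc j₀) ≤ at (treeHeights B) j₀ → RotationWithShift B (suc j₀)
descent⇒Rot leaf j₀ () desc
descent⇒Rot (bin B₁ B₂) j₀ j<len desc with <-cmp (suc j₀) (length (treeHeights B₁))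
... | tri< j<L₁ _ _ = inLeft
  where
  L₁ : List ℕ
  L₁ = treeHeights B₁
  L≡ : treeHeights (bin B₁ B₂) ≡ L₁ ++ 0 ∷ map suc (treeHeights B₂)
  L≡ = treeHeights-bin B₁ B₂
  inLeft : RotationWithShift (bin B₁ B₂) (suc j₀)
  inLeft with descent⇒Rot B₁ j₀ j<L₁ (descent-++ˡ L₁ _ j<L₁ (subst (λ L → at L (suc j₀) ≤ at L j₀) L≡ desc))
  ... | C₁ , m , r , sh = bin C₁ B₂ , m , left r ,
    subst₂ (λ u v → ListShift u v (suc j₀) m) (sym L≡) (sym (treeHeights-bin C₁ B₂)) (shift-++ʳ _ sh)
... | tri≈ _ j≡L₁ _ = rotation-at-root B₁ B₂ j≡L₁
... | tri> _ _ L₁<j = inRight (<⊎≡+ (length P) j₀)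
  where
  L₁ L₂ P : List ℕ
  L₁ = treeHeights B₁
  L₂ = treeHeights B₂
  P = L₁ ++ [ 0 ]
  L≡ : treeHeights (bin B₁ B₂) ≡ P ++ map suc L₂
  L≡ = treeHeights-bin-assoc B₁ B₂
  lenP : length P ≡ suc (length L₁)
  lenP = trans (length-++ L₁) (+-comm (length L₁) 1)
  inRight : j₀ < length P ⊎ Σ ℕ (λ t → j₀ ≡ length P + t) → RotationWithShift (bin B₁ B₂) (suc j₀)
  inRight (inj₁ j₀<P) = ⊥-elim (no-descent-after-root L₁ L₂
    (subst (λ j → suc j < length (L₁ ++ 0 ∷ map suc L₂)) j₀≡L₁
      (subst (λ L → suc j₀ < length L) (treeHeights-bin B₁ B₂) j<len))
    (subst (λ j → at (L₁ ++ 0 ∷ map suc L₂) (suc j) ≤ at (L₁ ++ 0 ∷ map suc L₂) j) j₀≡L₁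
      (subst (λ L → at L (suc j₀) ≤ at L j₀) (treeHeights-bin B₁ B₂) desc)))
    where
    j₀≡L₁ : j₀ ≡ length L₁
    j₀≡L₁ = ≤-antisym (≤-pred (subst (j₀ <_) lenP j₀<P)) (≤-pred L₁<j)
  inRight (inj₂ (t , j₀≡)) with descent-++-map-suc P L₂
    (subst₂ (λ j L → suc j < length L) j₀≡ L≡ j<len) (subst₂ (λ j L → at L (suc j) ≤ at L j) j₀≡ L≡ desc)
  ... | t<L₂ , descL₂ with descent⇒Rot B₂ t t<L₂ descL₂
  ...   | C₂ , m , r , sh = bin B₁ C₂ , length P + m , right r ,
    subst (λ j → ListShift (treeHeights (bin B₁ B₂)) (treeHeights (bin B₁ C₂)) j (length P + m))
      (trans (+-suc (length P) t) (cong suc (sym j₀≡)))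
      (subst₂ (λ u v → ListShift u v (length P + suc t) (length P + m)) (sym L≡) (sym (treeHeights-bin-assoc B₁ C₂))
        (shift-++ˡ P (shift-map-suc sh)))

-- Parent-monotonicity of δ along rotations

-- δ≤ E F a b says δ_a ≤ δ_b for δ = F − E, without subtraction.
δ≤ : (E F : ℕ → ℕ) → ℕ → ℕ → Set
δ≤ E F a b = F a + E b ≤ F b + E a

ParentMonotone : (E F : ℕ → ℕ) → ℕ → Set
ParentMonotone E F n = ∀ a b → b < n → IsParent E a b → δ≤ E F a b

δ≤-refl : ∀ E a b → δ≤ E E a b
δ≤-refl E a b = ≤-reflexive (+-comm (E a) (E b))

δ≤-trans : ∀ E F {a c b} → δ≤ E F a c → δ≤ E F c b → δ≤ E F a b
δ≤-trans E F {a} {c} {b} ac cb = +-cancelʳ-≤ (F c + E c) _ _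
  (subst₂ _≤_ (regroupˡ (F a) (E c) (F c) (E b)) (regroupʳ (F c) (E a) (F b) (E c)) (+-mono-≤ ac cb))
  where
  regroupˡ : ∀ x y z w → (x + y) + (z + w) ≡ (x + w) + (z + y)
  regroupˡ = solve-∀
  regroupʳ : ∀ x y z w → (x + y) + (z + w) ≡ (z + y) + (x + w)
  regroupʳ = solve-∀

δ≤-offset : ∀ E E′ F c {a b} → E′ a ≡ c + E a → E′ b ≡ c + E b → δ≤ E′ F a b ⇔ δ≤ E F a b
δ≤-offset E E′ F c {a} {b} Ea Eb = mk⇔
  (λ le → +-cancelˡ-≤ c _ _ (subst₂ _≤_ lhs rhs le))
  (λ le → subst₂ _≤_ (sym lhs) (sym rhs) (+-monoʳ-≤ c le))
  where
  swap : ∀ x c y → x + (c + y) ≡ c + (x + y)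
  swap = solve-∀
  lhs : F a + E′ b ≡ c + (F a + E b)
  lhs = trans (cong (F a +_) Eb) (swap (F a) c (E b))
  rhs : F b + E′ a ≡ c + (F b + E a)
  rhs = trans (cong (F b +_) Ea) (swap (F b) c (E a))

IsParent-offset : ∀ E E′ c {a b} → (∀ k → a ≤ k → k ≤ b → E′ k ≡ c + E k) → IsParent E′ a b ⇔ IsParent E a b
IsParent-offset E E′ c {a} {b} E′≡ = mk⇔
  (λ (a<b , eq , above) → a<b ,
    +-cancelˡ-≡ c _ _ (trans (+-suc c (E a)) (trans (cong suc (sym (Ea a<b))) (trans eq (Eb a<b)))) ,
    λ k a<k k<b → +-cancelˡ-< c _ _ (subst₂ _<_ (Ea a<b) (E′≡ k (<⇒≤ a<k) (<⇒≤ k<b)) (above k a<k k<b)))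
  (λ (a<b , eq , above) → a<b ,
    trans (cong suc (Ea a<b)) (trans (sym (+-suc c (E a))) (trans (cong (c +_) eq) (sym (Eb a<b)))) ,
    λ k a<k k<b → subst₂ _<_ (sym (Ea a<b)) (sym (E′≡ k (<⇒≤ a<k) (<⇒≤ k<b))) (+-monoʳ-< c (above k a<k k<b)))
  where
  Ea : a < b → E′ a ≡ c + E a
  Ea a<b = E′≡ a ≤-refl (<⇒≤ a<b)
  Eb : a < b → E′ b ≡ c + E b
  Eb a<b = E′≡ b (<⇒≤ a<b) ≤-refl

IsParent-raise : ∀ E E′ {a b} → E′ a ≡ E a → E′ b ≡ E b → (∀ k → E k ≤ E′ k) →
  IsParent E a b → IsParent E′ a b
IsParent-raise E E′ Ea Eb E≤E′ (a<b , eq , above) = a<b , trans (cong suc Ea) (trans eq (sym Eb)) ,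
  λ k a<k k<b → subst (_< E′ k) (sym Ea) (<-≤-trans (above k a<k k<b) (E≤E′ k))

-- For heights rising by at most one per step, the last index before b that
-- is lower than b is the parent of b.
parent-exists : ∀ E → (∀ k → E (suc k) ≤ suc (E k)) → ∀ {a b} → a < b → E a < E b →
  Σ ℕ λ c → a ≤ c × IsParent E c b
parent-exists E step {a} {b} a<b Ea<Eb with last-below (λ i → E i < E b) (λ i → E i <? E b) a<b Ea<Eb
... | c , a≤c , c<b , Ec<Eb , after = c , a≤c , c<b , ≤-antisym Ec<Eb (≤-trans Eb≤E[1+c] (step c)) ,
  λ k c<k k<b → <-≤-trans Ec<Eb (≮⇒≥ (after k c<k k<b))
  where
  Eb≤E[1+c] : E b ≤ E (suc c)
  Eb≤E[1+c] with m≤n⇒m<n∨m≡n c<b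
  ... | inj₁ 1+c<b = ≮⇒≥ (after (suc c) (n<1+n c) 1+c<b)
  ... | inj₂ refl = ≤-refl

data Region (j m i : ℕ) : Set where
  before : i < j → Region j m i
  inside : j ≤ i → i < m → Region j m i
  after  : m ≤ i → Region j m i

region : ∀ j m i → Region j m i
region j m i with i <? j | i <? m
... | yes i<j | _ = before i<j
... | no i≮j | yes i<m = inside (≮⇒≥ i≮j) i<m
... | no _ | no i≮m = after (≮⇒≥ i≮m)

no-parent-across : ∀ G {a m b} → a < m → m ≤ b → G m ≤ G a → ¬ IsParent G a b
no-parent-across G {a} {m} a<m m≤b Gm≤Ga (_ , eq , above) with m≤n⇒m<n∨m≡n m≤b
... | inj₁ m<b = <⇒≱ (above m a<m m<b) Gm≤Ga
... | inj₂ refl = 1+n≰n (subst (_≤ G a) (sym eq) Gm≤Ga)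

module Shifted {E E′ : ℕ → ℕ} {n j m : ℕ} (sh : Shift E E′ n j m) where
  open Shift sh

  E≤E′ : ∀ k → E k ≤ E′ k
  E≤E′ k with region j m k
  ... | before k<j = ≤-reflexive (sym (fixedˡ k k<j))
  ... | inside j≤k k<m = ≤-trans (n≤1+n _) (≤-reflexive (sym (raised k j≤k k<m)))
  ... | after m≤k = ≤-reflexive (sym (fixedʳ k m≤k))

  start≤ : ∀ {a} → j ≤ a → a < m → E j ≤ E a
  start≤ j≤a a<m with m≤n⇒m<n∨m≡n j≤a
  ... | inj₁ j<a = <⇒≤ (interior _ j<a a<m)
  ... | inj₂ refl = ≤-refl

  exit≤ : ∀ {a} → j ≤ a → a < m → E m ≤ E a
  exit≤ j≤a a<m = ≤-trans exit (start≤ j≤a a<m)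

  -- In the rotated sequence j is one level higher, so its parent c there is a
  -- sibling of j in the original sequence, and a is the parent of c.
  parent-of-start : ∀ F → (∀ k → E′ (suc k) ≤ suc (E′ k)) →
    ∀ {a} → j < n → a < j → IsParent E a j → ParentMonotone E′ F n → δ≤ E F a j
  parent-of-start F step′ {a} j<n a<j (_ , Ea+1≡Ej , above) H′ = δ≤-trans E F δac δcj
    where
    E′a≡ : E′ a ≡ E a
    E′a≡ = fixedˡ a a<j
    E′j≡ : E′ j ≡ suc (E j)
    E′j≡ = raised j ≤-refl j<m
    found : Σ ℕ λ c → a ≤ c × IsParent E′ c j
    found = parent-exists E′ step′ a<j (subst₂ _<_ (sym E′a≡) (sym E′j≡) (≤-trans (≤-reflexive Ea+1≡Ej) (n≤1+n _)))
    c : ℕ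
    c = proj₁ found
    a≤c : a ≤ c
    a≤c = proj₁ (proj₂ found)
    parent′ : IsParent E′ c j
    parent′ = proj₂ (proj₂ found)
    c<j : c < j
    c<j = proj₁ parent′
    Ec≡Ej : E c ≡ E j
    Ec≡Ej = suc-injective (trans (cong suc (sym (fixedˡ c c<j))) (trans (proj₁ (proj₂ parent′)) E′j≡))
    a<c : a < c
    a<c with m≤n⇒m<n∨m≡n a≤c
    ... | inj₁ a<c = a<c
    ... | inj₂ a≡c = ⊥-elim (1+n≰n (≤-reflexive (trans Ea+1≡Ej (trans (sym Ec≡Ej) (cong E (sym a≡c))))))
    parent : IsParent E a c
    parent = a<c , trans Ea+1≡Ej (sym Ec≡Ej) , λ k a<k k<c → above k a<k (<-trans k<c c<j)
    δac : δ≤ E F a c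
    δac = Equivalence.to (δ≤-offset E E′ F 0 E′a≡ (fixedˡ c c<j))
      (H′ a c (<-trans c<j j<n) (IsParent-raise E E′ E′a≡ (fixedˡ c c<j) E≤E′ parent))
    δcj : δ≤ E F c j
    δcj = ≤-trans (+-monoʳ-≤ (F c) (n≤1+n (E j)))
      (subst₂ _≤_ (cong (F c +_) E′j≡) (cong (F j +_) (fixedˡ c c<j)) (H′ c j j<n parent′))

  ParentMonotone-lower : ∀ F → (∀ k → E′ (suc k) ≤ suc (E′ k)) → ParentMonotone E′ F n → ParentMonotone E F n
  ParentMonotone-lower F step′ H′ a b b<n par@(a<b , eq , above) = by-regions (region j m a) (region j m b)
    where
    unchanged : E′ a ≡ E a → E′ b ≡ E b → δ≤ E F a b
    unchanged E′a E′b =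
      Equivalence.to (δ≤-offset E E′ F 0 E′a E′b) (H′ a b b<n (IsParent-raise E E′ E′a E′b E≤E′ par))
    offset : ∀ c → (∀ k → a ≤ k → k ≤ b → E′ k ≡ c + E k) → δ≤ E F a b
    offset c E′≡ = Equivalence.to (δ≤-offset E E′ F c (E′≡ a ≤-refl (<⇒≤ a<b)) (E′≡ b (<⇒≤ a<b) ≤-refl))
      (H′ a b b<n (Equivalence.from (IsParent-offset E E′ c E′≡) par))
    by-regions : Region j m a → Region j m b → δ≤ E F a b
    by-regions (before a<j) (before b<j) = unchanged (fixedˡ a a<j) (fixedˡ b b<j)
    by-regions (before a<j) (after m≤b) = unchanged (fixedˡ a a<j) (fixedʳ b m≤b)
    by-regions (before a<j) (inside j≤b b<m) with m≤n⇒m<n∨m≡n j≤b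
    ... | inj₁ j<b = ⊥-elim (<⇒≱ (interior b j<b b<m) (≤-trans (≤-reflexive (sym eq)) (above j a<j j<b)))
    ... | inj₂ j≡b = subst (δ≤ E F a) j≡b
      (parent-of-start F step′ (subst (_< n) (sym j≡b) b<n) a<j (subst (IsParent E a) (sym j≡b) par) H′)
    by-regions (inside j≤a a<m) (before b<j) = ⊥-elim (<⇒≱ (<-trans a<b b<j) j≤a)
    by-regions (inside j≤a a<m) (inside j≤b b<m) =
      offset 1 (λ k a≤k k≤b → raised k (≤-trans j≤a a≤k) (≤-<-trans k≤b b<m))
    by-regions (inside j≤a a<m) (after m≤b) = ⊥-elim (no-parent-across E a<m m≤b (exit≤ j≤a a<m) par)
    by-regions (after m≤a) (before b<j) = ⊥-elim (<⇒≱ (<-trans a<b b<j) (≤-trans (<⇒≤ j<m) m≤a))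
    by-regions (after m≤a) (inside j≤b b<m) = ⊥-elim (<⇒≱ (<-trans a<b b<m) m≤a)
    by-regions (after m≤a) (after m≤b) = offset 0 (λ k a≤k _ → fixedʳ k (≤-trans m≤a a≤k))

≤Tam⇒ParentMonotone : ∀ {B C} → B ≤Tam C →
  ParentMonotone (at (treeHeights B)) (at (treeHeights C)) (length (treeHeights B))
≤Tam⇒ParentMonotone {B} ε a b _ _ = δ≤-refl (at (treeHeights B)) a b
≤Tam⇒ParentMonotone {C = C} (_◅_ {j = B′} r B′≤C) with Rot⇒Shift r
... | _ , _ , mkListShift sh len = Shifted.ParentMonotone-lower sh (at (treeHeights C)) (heights-step 0 (σ B′))
  (λ a b b<n → ≤Tam⇒ParentMonotone B′≤C a b (subst (b <_) (sym len) b<n))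

-- Climbing from P to Q

δ≤-gap : ∀ E F {c k} → δ≤ E F c k → E c < F c → E k < F k
δ≤-gap E F {c} {k} δck Ec<Fc = +-cancelˡ-< (F c) (E k) (F k)
  (subst (F c + E k <_) (+-comm (F k) (F c)) (≤-<-trans δck (+-monoʳ-< (F k) Ec<Fc)))

module FirstGap {E E′ F : ℕ → ℕ} {n j m : ℕ} (sh : Shift E E′ n j m)
  (step : ∀ k → E (suc k) ≤ suc (E k))
  (agree : ∀ i → i < j → E i ≡ F i)
  (Ej<Fj : E j < F j)
  (E≤F : ∀ i → i ≤ n → E i ≤ F i)
  (H : ParentMonotone E F n) where
  open Shift sh
  open Shifted sh

  below-in-block : ∀ k → j ≤ k → k < m → E k < F k
  below-in-block = <-rec (λ k → j ≤ k → k < m → E k < F k) go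
    where
    go : ∀ k → (∀ {c} → c < k → j ≤ c → c < m → E c < F c) → j ≤ k → k < m → E k < F k
    go k rec j≤k k<m with m≤n⇒m<n∨m≡n j≤k
    ... | inj₂ refl = Ej<Fj
    ... | inj₁ j<k with parent-exists E step j<k (interior k j<k k<m)
    ...   | c , j≤c , par = δ≤-gap E F (H c k (<-≤-trans k<m m≤n) par) (rec (proj₁ par) j≤c (<-trans (proj₁ par) k<m))

  E′≤F : ∀ i → i ≤ n → E′ i ≤ F i
  E′≤F i i≤n with region j m i
  ... | before i<j = subst (_≤ F i) (sym (fixedˡ i i<j)) (E≤F i i≤n)
  ... | inside j≤i i<m = subst (_≤ F i) (sym (raised i j≤i i<m)) (below-in-block i j≤i i<m)
  ... | after m≤i = subst (_≤ F i) (sym (fixedʳ i m≤i)) (E≤F i i≤n)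

  ParentMonotone-raise : ParentMonotone E′ F n
  ParentMonotone-raise a b b<n par@(a<b , _ , _) = by-region (region j m a)
    where
    offset : ∀ c → (∀ k → a ≤ k → k ≤ b → E′ k ≡ c + E k) → δ≤ E′ F a b
    offset c E′≡ = Equivalence.from (δ≤-offset E E′ F c (E′≡ a ≤-refl (<⇒≤ a<b)) (E′≡ b (<⇒≤ a<b) ≤-refl))
      (H a b b<n (Equivalence.to (IsParent-offset E E′ c E′≡) par))
    by-region : Region j m a → δ≤ E′ F a b
    by-region (before a<j) = subst (λ x → F a + E′ b ≤ F b + x) (sym (trans (fixedˡ a a<j) (agree a a<j)))
      (≤-trans (+-monoʳ-≤ (F a) (E′≤F b (<⇒≤ b<n))) (≤-reflexive (+-comm (F a) (F b))))
    by-region (after m≤a) = offset 0 (λ k a≤k _ → fixedʳ k (≤-trans m≤a a≤k))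
    by-region (inside j≤a a<m) with region j m b
    ... | before b<j = ⊥-elim (<⇒≱ (<-trans a<b b<j) j≤a)
    ... | inside j≤b b<m = offset 1 (λ k a≤k k≤b → raised k (≤-trans j≤a a≤k) (≤-<-trans k≤b b<m))
    ... | after m≤b = ⊥-elim (no-parent-across E′ a<m m≤b E′m≤E′a par)
      where
      E′m≤E′a : E′ m ≤ E′ a
      E′m≤E′a = subst (_≤ E′ a) (sym (fixedʳ m ≤-refl)) (≤-trans (exit≤ j≤a a<m) (E≤E′ a))

sumBelow : (ℕ → ℕ) → ℕ → ℕ
sumBelow E zero = 0
sumBelow E (suc n) = sumBelow E n + E n

sumBelow-mono : ∀ E F n → (∀ i → i < n → E i ≤ F i) → sumBelow E n ≤ sumBelow F n
sumBelow-mono E F zero _ = z≤n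
sumBelow-mono E F (suc n) E≤F = +-mono-≤ (sumBelow-mono E F n (λ i i<n → E≤F i (<-trans i<n (n<1+n n)))) (E≤F n (n<1+n n))

sumBelow-strict : ∀ E F n {j} → (∀ i → i < n → E i ≤ F i) → j < n → E j < F j → sumBelow E n < sumBelow F n
sumBelow-strict E F (suc n) {j} E≤F j<1+n Ej<Fj with m≤n⇒m<n∨m≡n (≤-pred j<1+n)
... | inj₂ refl = +-mono-≤-< (sumBelow-mono E F j (λ i i<j → E≤F i (<-trans i<j (n<1+n j)))) Ej<Fj
... | inj₁ j<n = +-mono-<-≤ (sumBelow-strict E F n (λ i i<n → E≤F i (<-trans i<n (n<1+n n))) j<n Ej<Fj) (E≤F n (n<1+n n))

record IsHeightSequence (F : ℕ → ℕ) (n : ℕ) : Set where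
  field
    step   : ∀ k → F (suc k) ≤ suc (F k)
    start  : F 0 ≡ 0
    beyond : ∀ i → n ≤ i → F i ≡ 0

height-isHeightSequence : ∀ {n} w → IsDyck n w → IsHeightSequence (height w) n
height-isHeightSequence w d = record
  { step = heights-step 0 w ; start = n≤0⇒n≡0 (head-heights≤ 0 w) ; beyond = λ i → height≡0 w d }

Below : (E F : ℕ → ℕ) → ℕ → Set
Below E F n = (∀ i → i ≤ n → E i ≤ F i) × ParentMonotone E F n

-- At the first index where E is strictly below F, E has a descent (F cannot
-- rise faster than by one), so a rotation starts there.
rotate-up : ∀ {n} F B → length (treeHeights B) ≡ n → IsHeightSequence F n →
  Below (at (treeHeights B)) F n → ∀ {i} → i ≤ n → at (treeHeights B) i < F i →
  (∀ k → k < i → ¬ at (treeHeights B) k < F k) →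
  Σ BTree λ C → Rot B C × length (treeHeights C) ≡ n × Below (at (treeHeights C)) F n ×
    sumBelow (at (treeHeights B)) n < sumBelow (at (treeHeights C)) n
rotate-up F B refl hs _ {zero} _ E0<F0 _ = ⊥-elim (n≮0 (subst (_ <_) (IsHeightSequence.start hs) E0<F0))
rotate-up F B refl hs (E≤F , H) {suc j₀} i≤n Ej<Fj first with descent⇒Rot B j₀ j<n descent
  where
  open IsHeightSequence hs
  E : ℕ → ℕ
  E = at (treeHeights B)
  j<n : suc j₀ < length (treeHeights B)
  j<n with m≤n⇒m<n∨m≡n i≤n
  ... | inj₁ j<n = j<n
  ... | inj₂ j≡n = ⊥-elim (n≮0 (subst (E (suc j₀) <_) (beyond (suc j₀) (≤-reflexive (sym j≡n))) Ej<Fj))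
  Ej₀≡Fj₀ : E j₀ ≡ F j₀
  Ej₀≡Fj₀ = ≤-antisym (E≤F j₀ (<⇒≤ (<-trans (n<1+n j₀) j<n))) (≮⇒≥ (first j₀ (n<1+n j₀)))
  descent : E (suc j₀) ≤ E j₀
  descent = ≮⇒≥ λ rise → <⇒≱ Ej<Fj (≤-trans (step j₀) (subst (λ x → suc x ≤ E (suc j₀)) Ej₀≡Fj₀ rise))
... | C , m , r , mkListShift sh len = C , r , len , (E′≤F , ParentMonotone-raise) ,
  sumBelow-strict E E′ _ (λ i _ → E≤E′ i) (<-≤-trans (Shift.j<m sh) (Shift.m≤n sh))
    (subst (E (suc j₀) <_) (sym (Shift.raised sh (suc j₀) ≤-refl (Shift.j<m sh))) (n<1+n _))
  where
  E E′ : ℕ → ℕ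
  E = at (treeHeights B)
  E′ = at (treeHeights C)
  agree : ∀ i → i < suc j₀ → E i ≡ F i
  agree i i<j = ≤-antisym (E≤F i (≤-trans (<⇒≤ i<j) i≤n)) (≮⇒≥ (first i i<j))
  open FirstGap sh (heights-step 0 (σ B)) agree Ej<Fj E≤F H
  open Shifted sh

-- Each rotation raises the height sum, which F bounds, so the fuel
-- sumBelow F n − sumBelow E n suffices.
climb : ∀ {n} F fuel B → length (treeHeights B) ≡ n → IsHeightSequence F n → Below (at (treeHeights B)) F n →
  sumBelow F n ≤ fuel + sumBelow (at (treeHeights B)) n →
  Σ BTree λ C → B ≤Tam C × length (treeHeights C) ≡ n × (∀ i → i ≤ n → at (treeHeights C) i ≡ F i)
climb {n} F fuel B lenB hs inv@(E≤F , _) fuel-bound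
  with least-or-none (λ i → at (treeHeights B) i < F i) (λ i → at (treeHeights B) i <? F i) n
... | inj₁ none = B , ε , lenB , λ i i≤n → ≤-antisym (E≤F i i≤n) (≮⇒≥ (none i i≤n))
... | inj₂ (i , i≤n , Ei<Fi , first) with rotate-up F B lenB hs inv i≤n Ei<Fi first | fuel
...   | C , r , lenC , invC@(E′≤F , _) , grows | zero =
  ⊥-elim (<⇒≱ (<-≤-trans grows (sumBelow-mono _ F n (λ i i<n → E′≤F i (<⇒≤ i<n)))) fuel-bound)
...   | C , r , lenC , invC , grows | suc fuel′ with climb F fuel′ C lenC hs invC
  (≤-trans fuel-bound (subst (_≤ fuel′ + sumBelow (at (treeHeights C)) n) (+-suc fuel′ _) (+-monoʳ-≤ fuel′ grows)))
...     | D , C≤D , lenD , D≡F = D , r ◅ C≤D , lenD , D≡F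

-≤-⇔ : ∀ a b c d → (ℤ.+ a ℤ.- ℤ.+ b ≤ℤ ℤ.+ c ℤ.- ℤ.+ d) ⇔ (a + d ≤ c + b)
-≤-⇔ a b c d = mk⇔
  (λ le → ℤₚ.drop‿+≤+ (subst₂ _≤ℤ_
    (trans (cancelʳ A B D) (sym (ℤₚ.pos-+ a d))) (trans (cancelˡ C B D) (sym (ℤₚ.pos-+ c b)))
    (ℤₚ.+-monoˡ-≤ (B ℤ.+ D) le)))
  (λ le → subst₂ _≤ℤ_ (trans (cong (ℤ._- (B ℤ.+ D)) (ℤₚ.pos-+ a d)) (uncancelʳ A B D))
    (trans (cong (ℤ._- (B ℤ.+ D)) (ℤₚ.pos-+ c b)) (uncancelˡ C B D)) (ℤₚ.+-monoˡ-≤ (ℤ.- (B ℤ.+ D)) (ℤ.+≤+ le)))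
  where
  A B C D : ℤ.ℤ
  A = ℤ.+ a
  B = ℤ.+ b
  C = ℤ.+ c
  D = ℤ.+ d
  cancelʳ : ∀ x y z → (x ℤ.- y) ℤ.+ (y ℤ.+ z) ≡ x ℤ.+ z
  cancelʳ = ℤ-Solver.solve-∀
  cancelˡ : ∀ x y z → (x ℤ.- z) ℤ.+ (y ℤ.+ z) ≡ x ℤ.+ y
  cancelˡ = ℤ-Solver.solve-∀
  uncancelʳ : ∀ x y z → (x ℤ.+ z) ℤ.- (y ℤ.+ z) ≡ x ℤ.- y
  uncancelʳ = ℤ-Solver.solve-∀
  uncancelˡ : ∀ x y z → (x ℤ.+ y) ℤ.- (y ℤ.+ z) ≡ x ℤ.- z
  uncancelˡ = ℤ-Solver.solve-∀

δ≤ℤ⇔δ≤ : ∀ {n} P Q → IsDyck n P → IsDyck n Q → ∀ {i j} → i ≤ n → j ≤ n →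
  (δ i P Q ≤ℤ δ j P Q) ⇔ δ≤ (height P) (height Q) i j
δ≤ℤ⇔δ≤ {n} P Q dP dQ {i} {j} i≤n j≤n =
  subst₂ (λ x y → (x ≤ℤ y) ⇔ δ≤ (height P) (height Q) i j) (sym (δ≡ i≤n)) (sym (δ≡ j≤n))
    (-≤-⇔ (height Q i) (height P i) (height Q j) (height P j))
  where
  δ≡ : ∀ {k} → k ≤ n → δ k P Q ≡ ℤ.+ height Q k ℤ.- ℤ.+ height P k
  δ≡ k≤n = cong₂ ℤ._-_ (e≡height Q dQ k≤n) (e≡height P dP k≤n)

e≤e⇒height≤ : ∀ {n} P Q → IsDyck n P → IsDyck n Q →
  (∀ i → i ≤ n → e i P ≤ℤ e i Q) → ∀ i → i ≤ n → height P i ≤ height Q i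
e≤e⇒height≤ P Q dP dQ e≤e i i≤n =
  ℤₚ.drop‿+≤+ (subst₂ _≤ℤ_ (e≡height P dP i≤n) (e≡height Q dQ i≤n) (e≤e i i≤n))

parentPairs⇔ : ∀ {n} T → IsDyck n (ω T) → ∀ {i j} →
  (i , j) ∈ parentPairs T ⇔ (j < n × IsParent (height (ω T)) i j)
parentPairs⇔ T d = mk⇔
  (λ ij → let (j< , par) = parentPairs-sound T ij in subst (_ <_) (#N-dyck (ω T) d) j< , par)
  (λ (j<n , par) → parentPairs-complete T (subst (_ <_) (sym (#N-dyck (ω T) d)) j<n) par)

≤T⇒ParentMonotone : ∀ {n P Q} → IsDyck n P → P ≤T Q → ParentMonotone (height P) (height Q) n
≤T⇒ParentMonotone dP (B , C , refl , refl , B≤C) a b b<n =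
  ≤Tam⇒ParentMonotone B≤C a b (subst (b <_) (sym (length-heights-dyck (σ B) dP)) b<n)

ParentMonotone⇒≤T : ∀ {n P Q} B → σ B ≡ P → IsDyck n P → IsDyck n Q →
  (∀ i → i ≤ n → height P i ≤ height Q i) → ParentMonotone (height P) (height Q) n → P ≤T Q
ParentMonotone⇒≤T {n} {Q = Q} B refl dP dQ P≤Q H with
  climb (height Q) (sumBelow (height Q) n) B (length-heights-dyck (σ B) dP) (height-isHeightSequence Q dQ) (P≤Q , H)
    (m≤m+n _ _)
... | C , B≤C , lenC , C≡Q = B , C , refl , σC≡Q , B≤C
  where
  σC≡Q : σ C ≡ Q
  σC≡Q = heights-injective 0 (σ C) Q (walk-σ 0 C) (proj₂ dQ) (at-extensional _ _
    (trans lenC (sym (length-heights-dyck Q dQ))) (λ i i< → C≡Q i (<⇒≤ (subst (i <_) lenC i<))))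

proposition4p6 : (n : ℕ) (P Q : List Step) → IsDyck n P → IsDyck n Q →
    (∀ i → i ≤ n → e i P ≤ℤ e i Q) →
    (T : PTree) → ω T ≡ P →
    (P ≤T Q) ⇔ (∀ i j → (i , j) ∈ parentPairs T → δ i P Q ≤ℤ δ j P Q)
proposition4p6 n P Q dP dQ e≤e T refl = mk⇔
  (λ P≤Q i j ij → let (j<n , par) = Equivalence.to pairs ij in
    Equivalence.from (δ⇔ par j<n) (≤T⇒ParentMonotone dP P≤Q i j j<n par))
  (λ H → ParentMonotone⇒≤T (binaryOf T) (σ-binaryOf T) dP dQ (e≤e⇒height≤ (ω T) Q dP dQ e≤e)
    (λ i j j<n par → Equivalence.to (δ⇔ par j<n) (H i j (Equivalence.from pairs (j<n , par)))))
  where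
  pairs : ∀ {i j} → (i , j) ∈ parentPairs T ⇔ (j < n × IsParent (height (ω T)) i j)
  pairs = parentPairs⇔ T dP
  δ⇔ : ∀ {i j} → IsParent (height (ω T)) i j → j < n →
    (δ i (ω T) Q ≤ℤ δ j (ω T) Q) ⇔ δ≤ (height (ω T)) (height Q) i j
  δ⇔ (i<j , _) j<n = δ≤ℤ⇔δ≤ (ω T) Q dP dQ (<⇒≤ (<-trans i<j j<n)) (<⇒≤ j<n)
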